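{- Let $C$ be a $[g_q(k,d),k,d]_q$ Griesmer code, let $a\in C$ with $\mathrm{wt}(a)=d$, and let $C'\subseteq C$ be a $[g_q(k-1,d),k-1,d]_q$ Griesmer subcode supplementary to $a$, i.e., $\langle a\rangle\cap C'=\{0\}$ and $\langle a\rangle+C'=C$. Then the restriction of the puncturing map $P_a:C\to\mathrm{Res}(C,a)$ to $C'$ is a bijection $C'\to\mathrm{Res}(C,a)$.
   Context: An $[n,k,d]_q$ code is a $k$-dimensional subspace of $\mathbb{F}_q^n$ with minimum nonzero Hamming weight $d$; $g_q(k,d)=\sum_{i=0}^{k-1}\lceil d/q^i\rceil$ and a code whose (effective) length is $g_q(k,d)$ is a Griesmer code; the effective length of a subcode is the number of coordinates where not all of its codewords vanish. $\mathrm{Res}(C,a)$ is obtained by deleting the coordinates in $\mathrm{supp}(a)=\{i:a_i\ne0\}$ from all codewords, and $P_a(c)$ deletes these coordinates from $c$. -}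

module Defs where

open import Level using (Level; _⊔_) renaming (suc to lsuc)
open import Data.Nat using (ℕ; zero; suc; _∸_; _^_; _≤_; NonZero) renaming (_+_ to _+ℕ_)
open import Data.Nat.Properties using (m^n≢0)
open import Data.Nat.DivMod using (_/_)
open import Data.Fin using (Fin; zero; suc)
open import Data.Fin.Subset using (Subset; ∣_∣) renaming (_∈_ to _∈ₛ_)
open import Data.Product using (Σ; ∃; _×_; _,_; proj₁)
open import Data.Unit using (tt)
open import Relation.Nullary using (¬_; does)
open import Relation.Binary using (Decidable)
open import Relation.Binary.PropositionalEquality as ≡ using (_≡_)
open import Function.Bundles using (Bijection; _⇔_)
open import Algebra.Bundles using (CommutativeRing)

⌈_/_⌉ : (d m : ℕ) → .{{_ : NonZero m}} → ℕ
⌈ d / m ⌉ = (d +ℕ m ∸ 1) / m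

record FiniteField (c ℓ : Level) : Set (lsuc (c ⊔ ℓ)) where
  field
    commutativeRing : CommutativeRing c ℓ
  open CommutativeRing commutativeRing public
  field
    0≉1     : ¬ (0# ≈ 1#)
    inverse : ∀ x → ¬ (x ≈ 0#) → ∃ λ y → x * y ≈ 1#
    _≟_     : Decidable _≈_
    size    : ℕ
    enum    : Bijection (≡.setoid (Fin size)) setoid

private
  fin⇒nonZero : ∀ {n} → Fin n → NonZero n
  fin⇒nonZero {suc n} _ = record { nonZero = tt }

module Codes {c ℓ : Level} (F : FiniteField c ℓ) where
  open FiniteField F public using (Carrier; _≈_; _+_; _*_; 0#; 1#; _≟_; size; enum)

  q : ℕ
  q = size

  instance
    q-nonZero : NonZero q
    q-nonZero = fin⇒nonZero (proj₁ (Bijection.surjective enum 0#))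

  g : ℕ → ℕ → ℕ
  g zero    d = 0
  g (suc k) d = g k d +ℕ ⌈_/_⌉ d (q ^ k) {{m^n≢0 q k}}

  Word : ℕ → Set c
  Word n = Fin n → Carrier

  _≈ᵥ_ : ∀ {n} → Word n → Word n → Set ℓ
  x ≈ᵥ y = ∀ i → x i ≈ y i

  0ᵥ : ∀ {n} → Word n
  0ᵥ _ = 0#

  _+ᵥ_ : ∀ {n} → Word n → Word n → Word n
  (x +ᵥ y) i = x i + y i

  _·_ : ∀ {n} → Carrier → Word n → Word n
  (λ₀ · x) i = λ₀ * x i

  wt : ∀ {n} → Word n → ℕ
  wt {zero}  x = 0
  wt {suc n} x = (if does (x zero ≟ 0#) then 0 else 1) +ℕ wt (λ i → x (suc i))
    where
    open import Data.Bool using (if_then_else_)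

  lincomb : ∀ {k n} → (Fin k → Carrier) → (Fin k → Word n) → Word n
  lincomb {zero}  λs b i = 0#
  lincomb {suc k} λs b i = λs zero * b zero i + lincomb (λ j → λs (suc j)) (λ j → b (suc j)) i

  Code : ∀ p → ℕ → Set (c ⊔ lsuc p)
  Code p n = Word n → Set p

  module _ {p : Level} {n : ℕ} where

    record IsSubspace (C : Code p n) : Set (c ⊔ ℓ ⊔ p) where
      field
        resp  : ∀ {x y} → x ≈ᵥ y → C x → C y
        zero∈ : C 0ᵥ
        +∈    : ∀ {x y} → C x → C y → C (x +ᵥ y)
        ·∈    : ∀ λ₀ {x} → C x → C (λ₀ · x)

    LinIndep : ∀ {k} → (Fin k → Word n) → Set (c ⊔ ℓ)
    LinIndep b = ∀ λs → lincomb λs b ≈ᵥ 0ᵥ → ∀ i → λs i ≈ 0#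

    HasDim : Code p n → ℕ → Set (c ⊔ ℓ ⊔ p)
    HasDim C k = Σ (Fin k → Word n) λ b →
      (∀ i → C (b i)) × LinIndep b × (∀ x → C x → ∃ λ λs → x ≈ᵥ lincomb λs b)

    HasMinDist : Code p n → ℕ → Set (c ⊔ ℓ ⊔ p)
    HasMinDist C d =
      (∀ x → C x → ¬ (x ≈ᵥ 0ᵥ) → d ≤ wt x) ×
      (∃ λ x → C x × ¬ (x ≈ᵥ 0ᵥ) × wt x ≡ d)

    IsLinearCode : Code p n → ℕ → ℕ → Set (c ⊔ ℓ ⊔ p)
    IsLinearCode C k d = IsSubspace C × HasDim C k × HasMinDist C d

    HasEffLength : Code p n → ℕ → Set (c ⊔ ℓ ⊔ p)
    HasEffLength C m = Σ (Subset n) λ S →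
      ∣ S ∣ ≡ m × (∀ i → (i ∈ₛ S) ⇔ (∃ λ x → C x × ¬ (x i ≈ 0#)))

    _⊆_ : Code p n → Code p n → Set (c ⊔ p)
    C' ⊆ C = ∀ x → C' x → C x

  Off : ∀ {n} → Word n → Set ℓ
  Off {n} a = Σ (Fin n) λ i → a i ≈ 0#

  P : ∀ {n} (a : Word n) → Word n → (Off a → Carrier)
  P a x (i , _) = x i

  Res : ∀ {p n} → Code p n → (a : Word n) → (Off a → Carrier) → Set (c ⊔ ℓ ⊔ p)
  Res C a r = ∃ λ x → C x × (∀ j → P a x j ≈ r j)

-- Two codewords of C' with the same image under P_a differ by a codeword z of C'
-- supported inside supp(a). Since a has minimum weight, z − μa ∈ C vanishes at a
-- chosen coordinate of supp(a) as well as off supp(a), so it has weight < d and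
-- must be 0; thus z ∈ ⟨a⟩ ∩ C' = {0}. Surjectivity is immediate from C = ⟨a⟩ + C',
-- since the ⟨a⟩-component vanishes off supp(a).
module Submission where

open import Defs
open import Level using (Level)
open import Data.Nat using (ℕ; _∸_; suc; _<_; _≤_; z≤n; s≤s)
open import Data.Nat.Properties using (m≤n⇒m≤1+n; m<n⇒m<1+n; <⇒≱)
open import Data.Product using (∃; ∃₂; _×_; _,_)
open import Data.Fin using (Fin; zero; suc)
open import Data.Fin.Properties using (all?; ¬∀⟶∃¬)
open import Data.Vec.Functional using (tail)
open import Data.Empty using (⊥-elim)
open import Function.Bundles using (_⇔_; Equivalence)
open import Relation.Binary.PropositionalEquality using (_≡_; subst)
open import Relation.Nullary using (¬_; yes; no)
open import Relation.Nullary.Decidable using (decidable-stable)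
open import Relation.Unary using (Pred) renaming (_⊆_ to _⊆ᵤ_)
import Algebra.Properties.Group as GroupProperties
import Algebra.Properties.Ring as RingProperties

module WordProperties {c ℓ : Level} (F : FiniteField c ℓ) where
  open Codes F hiding (_⊆_)
  open FiniteField F
    using (-_; ring; +-group; refl; sym; trans; +-cong; *-cong; *-assoc; *-comm;
           *-identityʳ; zeroˡ; zeroʳ; +-identityˡ; inverse)
  open GroupProperties +-group using (x∙y⁻¹≈ε⇒x≈y; x≈y⇒x∙y⁻¹≈ε)
  open RingProperties ring using (-1*x≈-x)

  -- Only scalar multiples are available in a subspace, so subtraction goes through −1.
  _-ᵥ_ : ∀ {n} → Word n → Word n → Word n
  x -ᵥ y = x +ᵥ ((- 1#) · y)

  -ᵥ≈0⇒≈ : ∀ {n} (x y : Word n) i → (x -ᵥ y) i ≈ 0# → x i ≈ y i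
  -ᵥ≈0⇒≈ x y i x-y≈0 = x∙y⁻¹≈ε⇒x≈y (x i) (y i) (trans (+-cong refl (sym (-1*x≈-x (y i)))) x-y≈0)

  ≈⇒-ᵥ≈0 : ∀ {n} (x y : Word n) i → x i ≈ y i → (x -ᵥ y) i ≈ 0#
  ≈⇒-ᵥ≈0 x y i x≈y = trans (+-cong refl (-1*x≈-x (y i))) (x≈y⇒x∙y⁻¹≈ε x≈y)

  zeros : ∀ {n} → Word n → Pred (Fin n) ℓ
  zeros x i = x i ≈ 0#

  ·+ᵥ-on-zeros : ∀ {n} λ₀ (a y : Word n) {j} → a j ≈ 0# → ((λ₀ · a) +ᵥ y) j ≈ y j
  ·+ᵥ-on-zeros λ₀ a y {j} aⱼ≈0 =
    trans (+-cong (trans (*-cong refl aⱼ≈0) (zeroʳ λ₀)) refl) (+-identityˡ (y j))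

  wt-mono : ∀ {n} (w a : Word n) → zeros a ⊆ᵤ zeros w → wt w ≤ wt a
  wt-mono {0}     w a a⊆w = z≤n
  wt-mono {suc n} w a a⊆w with w zero ≟ 0# | a zero ≟ 0#
  ... | yes _    | yes _    = wt-mono (tail w) (tail a) a⊆w
  ... | yes _    | no _     = m≤n⇒m≤1+n (wt-mono (tail w) (tail a) a⊆w)
  ... | no w₀≉0  | yes a₀≈0 = ⊥-elim (w₀≉0 (a⊆w a₀≈0))
  ... | no _     | no _     = s≤s (wt-mono (tail w) (tail a) a⊆w)

  wt-strictMono : ∀ {n} (w a : Word n) → zeros a ⊆ᵤ zeros w →
                  ∀ i → w i ≈ 0# → ¬ a i ≈ 0# → wt w < wt a
  wt-strictMono {suc n} w a a⊆w zero w₀≈0 a₀≉0 with w zero ≟ 0# | a zero ≟ 0#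
  ... | yes _   | no _     = s≤s (wt-mono (tail w) (tail a) a⊆w)
  ... | no w₀≉0 | _        = ⊥-elim (w₀≉0 w₀≈0)
  ... | yes _   | yes a₀≈0 = ⊥-elim (a₀≉0 a₀≈0)
  wt-strictMono {suc n} w a a⊆w (suc i) wᵢ≈0 aᵢ≉0 with w zero ≟ 0# | a zero ≟ 0#
  ... | yes _    | yes _    = wt-strictMono (tail w) (tail a) a⊆w i wᵢ≈0 aᵢ≉0
  ... | yes _    | no _     = m<n⇒m<1+n (wt-strictMono (tail w) (tail a) a⊆w i wᵢ≈0 aᵢ≉0)
  ... | no w₀≉0  | yes a₀≈0 = ⊥-elim (w₀≉0 (a⊆w a₀≈0))
  ... | no _     | no _     = s≤s (wt-strictMono (tail w) (tail a) a⊆w i wᵢ≈0 aᵢ≉0)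

  module MinimumWeight {p n d} {C : Code p n} (C-subspace : IsSubspace C)
                       (d≤wt : ∀ x → C x → ¬ (x ≈ᵥ 0ᵥ) → d ≤ wt x) where
    open IsSubspace C-subspace

    wt<minDist⇒≈0 : ∀ {x} → C x → wt x < d → x ≈ᵥ 0ᵥ
    wt<minDist⇒≈0 {x} x∈C wt<d i = decidable-stable (x i ≟ 0#)
      λ xᵢ≉0 → <⇒≱ wt<d (d≤wt x x∈C (λ x≈0 → xᵢ≉0 (x≈0 i)))

    -- The scalar μ is chosen so that w − μa also vanishes at a coordinate of supp(a).
    supportedByMinWeight⇒multiple : ∀ {a w} → C a → wt a ≡ d → C w →
                                    zeros a ⊆ᵤ zeros w → ∃ λ μ → w ≈ᵥ (μ · a)
    supportedByMinWeight⇒multiple {a} {w} a∈C wt-a≡d w∈C a⊆w with all? (λ i → a i ≟ 0#)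
    ... | yes a≈0 = 0# , λ j → trans (a⊆w (a≈0 j)) (sym (zeroˡ (a j)))
    ... | no a≉0 with ¬∀⟶∃¬ n (zeros a) (λ i → a i ≟ 0#) a≉0
    ...   | i , aᵢ≉0 with inverse (a i) aᵢ≉0
    ...     | aᵢ⁻¹ , aᵢaᵢ⁻¹≈1 = μ , λ j → -ᵥ≈0⇒≈ w (μ · a) j (r≈0 j)
      where
      μ : Carrier
      μ = w i * aᵢ⁻¹

      r : Word n
      r = w -ᵥ (μ · a)

      μaᵢ≈wᵢ : μ * a i ≈ w i
      μaᵢ≈wᵢ = trans (*-assoc (w i) aᵢ⁻¹ (a i))
                 (trans (*-cong refl (trans (*-comm aᵢ⁻¹ (a i)) aᵢaᵢ⁻¹≈1)) (*-identityʳ (w i)))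

      a⊆r : zeros a ⊆ᵤ zeros r
      a⊆r {j} aⱼ≈0 = ≈⇒-ᵥ≈0 w (μ · a) j
        (trans (a⊆w aⱼ≈0) (sym (trans (*-cong refl aⱼ≈0) (zeroʳ μ))))

      r≈0 : r ≈ᵥ 0ᵥ
      r≈0 = wt<minDist⇒≈0 (+∈ w∈C (·∈ (- 1#) (·∈ μ a∈C)))
        (subst (wt r <_) wt-a≡d
          (wt-strictMono r a a⊆r i (≈⇒-ᵥ≈0 w (μ · a) i (sym μaᵢ≈wᵢ)) aᵢ≉0))

lemma4p5 : ∀ {c ℓ p : Level} (F : FiniteField c ℓ) → let open Codes F in
    (k d : ℕ) (C C' : Code p (g k d)) (a : Word (g k d)) →
    IsLinearCode C k d →
    C a → wt a ≡ d →
    C' ⊆ C → IsLinearCode C' (k ∸ 1) d → HasEffLength C' (g (k ∸ 1) d) →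
    (∀ x → C' x → (∃ λ λ₀ → x ≈ᵥ (λ₀ · a)) → x ≈ᵥ 0ᵥ) →
    (∀ x → C x ⇔ (∃₂ λ λ₀ y → C' y × x ≈ᵥ ((λ₀ · a) +ᵥ y))) →
    (∀ x → C' x → Res C a (P a x)) ×
    (∀ x y → C' x → C' y → (∀ j → P a x j ≈ P a y j) → x ≈ᵥ y) ×
    (∀ r → Res C a r → ∃ λ x → C' x × (∀ j → P a x j ≈ r j))
lemma4p5 F k d C C' a (C-subspace , _ , d≤wt , _) a∈C wt-a≡d C'⊆C (C'-subspace , _) _
         ⟨a⟩∩C'≈0 C≈⟨a⟩+C' = into , injective , surjective
  where
  open Codes F
  open FiniteField F using (refl; sym; trans)
  open WordProperties F
  open MinimumWeight C-subspace d≤wt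
  open IsSubspace C'-subspace using (+∈; ·∈)

  into : ∀ x → C' x → Res C a (P a x)
  into x x∈C' = x , C'⊆C x x∈C' , λ _ → refl

  injective : ∀ x y → C' x → C' y → (∀ j → P a x j ≈ P a y j) → x ≈ᵥ y
  injective x y x∈C' y∈C' Pa-x≈Pa-y i = -ᵥ≈0⇒≈ x y i (x-y≈0 i)
    where
    x-y∈C' : C' (x -ᵥ y)
    x-y∈C' = +∈ x∈C' (·∈ _ y∈C')

    a⊆x-y : zeros a ⊆ᵤ zeros (x -ᵥ y)
    a⊆x-y {j} aⱼ≈0 = ≈⇒-ᵥ≈0 x y j (Pa-x≈Pa-y (j , aⱼ≈0))

    x-y≈0 : (x -ᵥ y) ≈ᵥ 0ᵥ
    x-y≈0 = ⟨a⟩∩C'≈0 _ x-y∈C'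
      (supportedByMinWeight⇒multiple a∈C wt-a≡d (C'⊆C _ x-y∈C') a⊆x-y)

  surjective : ∀ r → Res C a r → ∃ λ x → C' x × (∀ j → P a x j ≈ r j)
  surjective r (x , x∈C , Pa-x≈r) with Equivalence.to (C≈⟨a⟩+C' x) x∈C
  ... | λ₀ , y , y∈C' , x≈λ₀a+y = y , y∈C' , λ (j , aⱼ≈0) →
        trans (sym (trans (x≈λ₀a+y j) (·+ᵥ-on-zeros λ₀ a y aⱼ≈0))) (Pa-x≈r (j , aⱼ≈0))
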